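{- The four matrices $S=[S(n,k)]_{n,k\ge0}$, $\hat S=[s(n,k)]_{n,k\ge0}$, $C=[C(n,k)]_{n,k\ge0}$ and $\hat C=[c(n,k)]_{n,k\ge0}$ are all totally positive.
   Context: For integers $n,k\ge 0$ let $S(n,k)$ be the number of $(x_1,\dots,x_k)\in\mathbb{Z}^k$ with $|x_1|+\cdots+|x_k|=n$ (so $\sum_{n\ge0}S(n,k)x^n=\left(\frac{1+x}{1-x}\right)^k$). Let $C(n,k)=S(n,k+1)$. Let $s(n,k)=S(n-k,k)$ and $c(n,k)=C(n-k,k)$ for $n\ge k\ge 0$, and $s(n,k)=c(n,k)=0$ for $k>n$. A matrix is totally positive if all its minors are nonnegative. -}

module Defs where

open import Data.Nat as ℕ using (ℕ; zero; suc; _∸_; _≤?_)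
open import Data.Integer as ℤ using (ℤ; +_; -_; ∣_∣)
open import Data.Fin as Fin using (Fin; zero; suc; toℕ; punchIn)
open import Data.List using (List; []; _∷_; map; concatMap; filter; length; upTo)
open import Data.Vec as Vec using (Vec; []; _∷_)
open import Relation.Nullary using (yes; no)

intRange : ℕ → List ℤ
intRange n = map (λ i → (+ i) ℤ.- (+ n)) (upTo (suc (n ℕ.+ n)))

boxVecs : ℕ → (k : ℕ) → List (Vec ℤ k)
boxVecs n zero = [] ∷ []
boxVecs n (suc k) = concatMap (λ x → map (x ∷_) (boxVecs n k)) (intRange n)

l1norm : ∀ {k} → Vec ℤ k → ℕ
l1norm [] = 0
l1norm (x ∷ xs) = ∣ x ∣ ℕ.+ l1norm xs

-- S(n,k) = #{ x ∈ ℤ^k : |x_1|+...+|x_k| = n }  (such x automatically lie in the box)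
S : ℕ → ℕ → ℕ
S n k = length (filter (λ v → l1norm v ℕ.≟ n) (boxVecs n k))

C : ℕ → ℕ → ℕ
C n k = S n (suc k)

s : ℕ → ℕ → ℕ
s n k with k ≤? n
... | yes _ = S (n ∸ k) k
... | no _ = 0

c : ℕ → ℕ → ℕ
c n k with k ≤? n
... | yes _ = C (n ∸ k) k
... | no _ = 0

sumFin : (m : ℕ) → (Fin m → ℤ) → ℤ
sumFin zero f = + 0
sumFin (suc m) f = f zero ℤ.+ sumFin m (λ i → f (suc i))

sign : ℕ → ℤ
sign zero = + 1
sign (suc n) = - sign n

det : (m : ℕ) → (Fin m → Fin m → ℤ) → ℤ
det zero A = + 1
det (suc m) A =
  sumFin (suc m) (λ j → sign (toℕ j) ℤ.* A zero j ℤ.* det m (λ i l → A (suc i) (punchIn j l)))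

StrictlyIncreasing : ∀ {m} → (Fin m → ℕ) → Set
StrictlyIncreasing {m} r = ∀ (i j : Fin m) → i Fin.< j → r i ℕ.< r j

TotallyPositive : (ℕ → ℕ → ℕ) → Set
TotallyPositive M =
  ∀ (m : ℕ) (r c : Fin m → ℕ) → StrictlyIncreasing r → StrictlyIncreasing c →
  + 0 ℤ.≤ det m (λ i j → + M (r i) (c j))

-- Column k of S has generating function ((1+x)/(1-x))^k, column k of ŝ is x^k times it, and column k of ĉ is
-- x^k ((1+x)/(1-x))^(k+1).  So each column is obtained from the previous one by taking partial sums (the factor
-- 1/(1-x)), adding the previous entry (1+x) and, for ŝ, shifting down (x).  Each of these row operations keeps the
-- minors with any fixed set of columns nonnegative: up to subtracting consecutive rows, the selected rows of the new
-- matrix are sums of rows of the old one over intervals that overlap at most in an endpoint, and multilinearity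
-- expands the determinant into minors of the old matrix with weakly increasing rows, each nonnegative or with two
-- equal rows.  Since the first column of S and ŝ is the unit vector e₀, induction on the columns gives total
-- positivity; ĉ is one more such operation applied to ŝ, and C is S without its first column.

module Submission where

open import Defs
open import Data.Product using (_×_; _,_)
open import Data.Nat as ℕ using (ℕ; zero; suc; _∸_; _≤?_; z≤n; s≤s; pred)
import Data.Nat.Properties as NP
import Data.Nat.Tactic.RingSolver as NS
open import Data.Integer as ℤ using (ℤ; +_; -_; ∣_∣)
import Data.Integer.Properties as ZP
open import Data.Integer.Tactic.RingSolver using (solve-∀)
open import Data.Fin as Fin using (Fin; zero; suc; toℕ; punchIn; inject₁)
import Data.Fin.Properties as FP
open import Function using (_∘_)
open import Data.Vec.Functional using (updateAt)
open import Data.Vec.Functional.Properties using (updateAt-updates; updateAt-minimal)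
open import Relation.Binary.PropositionalEquality
open import Relation.Nullary using (yes; no; does)
open import Data.Empty using (⊥-elim)
import Algebra.Properties.Semiring.Sum as SemiringSum
open import Level using (0ℓ)
open import Data.Bool using (true; false)
open import Data.List using (List; []; _∷_; _++_; map; concatMap; filter; length; applyUpTo; upTo)
import Data.List.Properties as LP
open import Data.List.Relation.Unary.All using (universal)
open import Data.Nat.ListAction using (sum)
open import Data.Vec using (Vec; _∷_)
open import Relation.Unary using (Pred; Decidable)

module ℤΣ = SemiringSum ZP.+-*-semiring

sumFin≡sum : ∀ m (f : Fin m → ℤ) → sumFin m f ≡ ℤΣ.sum f
sumFin≡sum zero f = refl
sumFin≡sum (suc m) f = cong (ℤ._+_ (f zero)) (sumFin≡sum m (f ∘ suc))

sumFin-cong : ∀ m {f g : Fin m → ℤ} → f ≗ g → sumFin m f ≡ sumFin m g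
sumFin-cong m {f} {g} f≗g =
  trans (sumFin≡sum m f) (trans (ℤΣ.sum-cong-≗ f≗g) (sym (sumFin≡sum m g)))

sumFin-zero : ∀ m {f : Fin m → ℤ} → (∀ i → f i ≡ + 0) → sumFin m f ≡ + 0
sumFin-zero m f≗0 = trans (sumFin-cong m f≗0) (trans (sumFin≡sum m _) (ℤΣ.sum-replicate-zero m))

sumFin-linear : ∀ m (a : ℤ) {f g h : Fin m → ℤ} → (∀ i → f i ≡ g i ℤ.+ a ℤ.* h i) →
                sumFin m f ≡ sumFin m g ℤ.+ a ℤ.* sumFin m h
sumFin-linear m a {f} {g} {h} f≗g+ah = begin
  sumFin m f                                    ≡⟨ sumFin-cong m f≗g+ah ⟩
  sumFin m (λ i → g i ℤ.+ a ℤ.* h i)            ≡⟨ sumFin≡sum m _ ⟩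
  ℤΣ.sum (λ i → g i ℤ.+ a ℤ.* h i)              ≡⟨ ℤΣ.∑-distrib-+ g (λ i → a ℤ.* h i) ⟩
  ℤΣ.sum g ℤ.+ ℤΣ.sum (λ i → a ℤ.* h i)         ≡⟨ cong (ℤ._+_ (ℤΣ.sum g)) (sym (ℤΣ.*-distribˡ-sum a h)) ⟩
  ℤΣ.sum g ℤ.+ a ℤ.* ℤΣ.sum h                   ≡⟨ sym (cong₂ (λ x y → x ℤ.+ a ℤ.* y) (sumFin≡sum m g) (sumFin≡sum m h)) ⟩
  sumFin m g ℤ.+ a ℤ.* sumFin m h               ∎
  where open ≡-Reasoning

sumFin-interchange : ∀ n (x y x′ y′ : Fin n → ℤ) (E : Fin n → Fin n → ℤ) →
  (∀ k q → x k ℤ.* y q ≡ y′ q ℤ.* x′ k) →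
  sumFin n (λ k → x k ℤ.* sumFin n (λ q → y q ℤ.* E q k)) ≡
  sumFin n (λ q → y′ q ℤ.* sumFin n (λ k → x′ k ℤ.* E q k))
sumFin-interchange n x y x′ y′ E xy≡y′x′ = begin
  sumFin n (λ k → x k ℤ.* sumFin n (λ q → y q ℤ.* E q k))
    ≡⟨ sumFin-cong n (λ k → trans (cong (ℤ._*_ (x k)) (sumFin≡sum n _)) (ℤΣ.*-distribˡ-sum {n} (x k) _)) ⟩
  sumFin n (λ k → ℤΣ.sum (λ q → x k ℤ.* (y q ℤ.* E q k)))
    ≡⟨ sumFin-cong n (λ k → ℤΣ.sum-cong-≗ (λ q → regroup (x k) (y q) (y′ q) (x′ k) (E q k) (xy≡y′x′ k q))) ⟩
  sumFin n (λ k → ℤΣ.sum (λ q → y′ q ℤ.* (x′ k ℤ.* E q k)))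
    ≡⟨ trans (sumFin≡sum n _) (ℤΣ.∑-comm (λ k q → y′ q ℤ.* (x′ k ℤ.* E q k))) ⟩
  ℤΣ.sum (λ q → ℤΣ.sum (λ k → y′ q ℤ.* (x′ k ℤ.* E q k)))
    ≡⟨ sym (trans (sumFin≡sum n _) (ℤΣ.sum-cong-≗ (λ q →
         trans (cong (ℤ._*_ (y′ q)) (sumFin≡sum n _)) (ℤΣ.*-distribˡ-sum {n} (y′ q) _)))) ⟩
  sumFin n (λ q → y′ q ℤ.* sumFin n (λ k → x′ k ℤ.* E q k))
    ∎
  where
  open ≡-Reasoning
  regroup : ∀ a b b′ a′ e → a ℤ.* b ≡ b′ ℤ.* a′ → a ℤ.* (b ℤ.* e) ≡ b′ ℤ.* (a′ ℤ.* e)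
  regroup a b b′ a′ e ab≡b′a′ =
    trans (sym (ZP.*-assoc a b e)) (trans (cong (ℤ._* e) ab≡b′a′) (ZP.*-assoc b′ a′ e))

sumUpTo : ℕ → (ℕ → ℕ) → ℕ
sumUpTo zero F = 0
sumUpTo (suc n) F = F 0 ℕ.+ sumUpTo n (F ∘ suc)

sumUpTo-split : ∀ a b F → sumUpTo (a ℕ.+ b) F ≡ sumUpTo a F ℕ.+ sumUpTo b (λ t → F (a ℕ.+ t))
sumUpTo-split zero b F = refl
sumUpTo-split (suc a) b F =
  trans (cong (F 0 ℕ.+_) (sumUpTo-split a b (F ∘ suc))) (sym (NP.+-assoc (F 0) _ _))

sumUpTo-snoc : ∀ n F → sumUpTo (suc n) F ≡ sumUpTo n F ℕ.+ F n
sumUpTo-snoc zero F = NP.+-comm (F 0) 0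
sumUpTo-snoc (suc n) F = trans (cong (F 0 ℕ.+_) (sumUpTo-snoc n (F ∘ suc))) (sym (NP.+-assoc (F 0) _ _))

sumUpTo-cong : ∀ n {F G : ℕ → ℕ} → (∀ i → i ℕ.< n → F i ≡ G i) → sumUpTo n F ≡ sumUpTo n G
sumUpTo-cong zero F≡G = refl
sumUpTo-cong (suc n) F≡G = cong₂ ℕ._+_ (F≡G 0 ℕ.z<s) (sumUpTo-cong n (λ i i<n → F≡G (suc i) (s≤s i<n)))

sumUpTo-zero : ∀ n {F : ℕ → ℕ} → (∀ i → i ℕ.< n → F i ≡ 0) → sumUpTo n F ≡ 0
sumUpTo-zero zero F≡0 = refl
sumUpTo-zero (suc n) F≡0 = cong₂ ℕ._+_ (F≡0 0 ℕ.z<s) (sumUpTo-zero n (λ i i<n → F≡0 (suc i) (s≤s i<n)))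

sumUpTo-reverse : ∀ n (F : ℕ → ℕ) → sumUpTo n (λ i → F (n ∸ i)) ≡ sumUpTo n (F ∘ suc)
sumUpTo-reverse zero F = refl
sumUpTo-reverse (suc n) F = trans (cong (F (suc n) ℕ.+_) (sumUpTo-reverse n F))
  (trans (NP.+-comm (F (suc n)) _) (sym (sumUpTo-snoc n (F ∘ suc))))

module ℕΣ = SemiringSum NP.+-*-semiring

≤-sum : ∀ {n} (f : Fin n → ℕ) i → f i ℕ.≤ ℕΣ.sum f
≤-sum {suc n} f i = NP.≤-trans (NP.m≤m+n (f i) _) (NP.≤-reflexive (sym (ℕΣ.sum-remove {i = i} f)))

sum-updateAt : ∀ {n} (f : Fin n → ℕ) i v → ℕΣ.sum (updateAt f i (λ _ → v)) ℕ.+ f i ≡ ℕΣ.sum f ℕ.+ v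
sum-updateAt {suc n} f i v = begin
  ℕΣ.sum f′ ℕ.+ f i                    ≡⟨ cong (ℕ._+ f i) (ℕΣ.sum-remove {i = i} f′) ⟩
  f′ i ℕ.+ ℕΣ.sum (f′ ∘ punchIn i) ℕ.+ f i
    ≡⟨ cong₂ (λ a b → a ℕ.+ b ℕ.+ f i) (updateAt-updates i f)
             (ℕΣ.sum-cong-≗ (λ j → updateAt-minimal (punchIn i j) i f (FP.punchInᵢ≢i i j))) ⟩
  v ℕ.+ ℕΣ.sum (f ∘ punchIn i) ℕ.+ f i ≡⟨ rearrange v (ℕΣ.sum (f ∘ punchIn i)) (f i) ⟩
  f i ℕ.+ ℕΣ.sum (f ∘ punchIn i) ℕ.+ v ≡⟨ cong (ℕ._+ v) (sym (ℕΣ.sum-remove {i = i} f)) ⟩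
  ℕΣ.sum f ℕ.+ v                       ∎
  where
  open ≡-Reasoning
  f′ = updateAt f i (λ _ → v)
  rearrange : ∀ a b c → a ℕ.+ b ℕ.+ c ≡ c ℕ.+ b ℕ.+ a
  rearrange = NS.solve-∀

sum-updateAt-< : ∀ {n} (f : Fin n → ℕ) i v → v ℕ.< f i → ℕΣ.sum (updateAt f i (λ _ → v)) ℕ.< ℕΣ.sum f
sum-updateAt-< f i v v<fᵢ = NP.+-cancelʳ-< (f i) _ _ (begin-strict
  ℕΣ.sum (updateAt f i (λ _ → v)) ℕ.+ f i ≡⟨ sum-updateAt f i v ⟩
  ℕΣ.sum f ℕ.+ v                          <⟨ NP.+-monoʳ-< (ℕΣ.sum f) v<fᵢ ⟩
  ℕΣ.sum f ℕ.+ f i                        ∎)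
  where open NP.≤-Reasoning

updateAt-≤ : ∀ {n} (f : Fin n → ℕ) i {v} → v ℕ.≤ f i → ∀ y → updateAt f i (λ _ → v) y ℕ.≤ f y
updateAt-≤ f i v≤fᵢ y with y FP.≟ i
... | yes refl = NP.≤-trans (NP.≤-reflexive (updateAt-updates i f)) v≤fᵢ
... | no y≢i = NP.≤-reflexive (updateAt-minimal y i f y≢i)

updateAt-≥ : ∀ {n} (f : Fin n → ℕ) i {v} → f i ℕ.≤ v → ∀ y → f y ℕ.≤ updateAt f i (λ _ → v) y
updateAt-≥ f i fᵢ≤v y with y FP.≟ i
... | yes refl = NP.≤-trans fᵢ≤v (NP.≤-reflexive (sym (updateAt-updates i f)))
... | no y≢i = NP.≤-reflexive (sym (updateAt-minimal y i f y≢i))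

-- Determinants

Matrix : ℕ → Set
Matrix m = Fin m → Fin m → ℤ

minor : ∀ {m} → Matrix (suc m) → Fin (suc m) → Fin (suc m) → Matrix m
minor A p q i l = A (punchIn p i) (punchIn q l)

firstRowTerm : ∀ {m} → Matrix (suc m) → Fin (suc m) → ℤ
firstRowTerm {m} A j = sign (toℕ j) ℤ.* A zero j ℤ.* det m (minor A zero j)

zero-middle : ∀ s {a} d → a ≡ + 0 → s ℤ.* a ℤ.* d ≡ + 0
zero-middle s d refl = trans (cong (ℤ._* d) (ZP.*-zeroʳ s)) (ZP.*-zeroˡ d)

zero-last : ∀ s a {d} → d ≡ + 0 → s ℤ.* a ℤ.* d ≡ + 0
zero-last s a refl = ZP.*-zeroʳ (s ℤ.* a)

det-cong : ∀ m {A B : Matrix m} → (∀ i j → A i j ≡ B i j) → det m A ≡ det m B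
det-cong zero A≡B = refl
det-cong (suc m) A≡B = sumFin-cong (suc m) (λ j →
  cong₂ (λ a d → sign (toℕ j) ℤ.* a ℤ.* d) (A≡B zero j) (det-cong m (λ i l → A≡B (suc i) (punchIn j l))))

det-zeroFirstRow : ∀ m (A : Matrix (suc m)) → (∀ l → A zero l ≡ + 0) → det (suc m) A ≡ + 0
det-zeroFirstRow m A row₀≡0 =
  sumFin-zero (suc m) (λ j → zero-middle (sign (toℕ j)) (det m (minor A zero j)) (row₀≡0 j))

det-zeroBelowCorner : ∀ m (A : Matrix (suc m)) → (∀ i → A (suc i) zero ≡ + 0) →
  det (suc m) A ≡ A zero zero ℤ.* det m (minor A zero zero)
det-zeroBelowCorner zero A _ = leadingTerm (A zero zero) (+ 1)
  where
  leadingTerm : ∀ a d → + 1 ℤ.* a ℤ.* d ℤ.+ + 0 ≡ a ℤ.* d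
  leadingTerm = solve-∀
det-zeroBelowCorner (suc m) A col₀≡0 =
  trans (cong (ℤ._+_ (+ 1 ℤ.* A zero zero ℤ.* D)) (sumFin-zero (suc m) laterTerm≡0)) (leadingTerm (A zero zero) D)
  where
  D = det (suc m) (minor A zero zero)
  leadingTerm : ∀ a d → + 1 ℤ.* a ℤ.* d ℤ.+ + 0 ≡ a ℤ.* d
  leadingTerm = solve-∀
  laterTerm≡0 : ∀ j → firstRowTerm A (suc j) ≡ + 0
  laterTerm≡0 j = zero-last (sign (toℕ (suc j))) (A zero (suc j))
    (trans (det-zeroBelowCorner m (minor A zero (suc j)) (col₀≡0 ∘ suc))
           (trans (cong (ℤ._* Dⱼ) (col₀≡0 zero)) (ZP.*-zeroˡ Dⱼ)))
    where Dⱼ = det m (minor (minor A zero (suc j)) zero zero)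

det-expandFirstColumn : ∀ m (A : Matrix (suc m)) →
  det (suc m) A ≡ sumFin (suc m) (λ p → sign (toℕ p) ℤ.* A p zero ℤ.* det m (minor A p zero))
det-expandFirstColumn zero A = refl
det-expandFirstColumn (suc m) A = cong (ℤ._+_ (firstRowTerm A zero)) (begin
  sumFin (suc m) (λ k → sign (toℕ (suc k)) ℤ.* A zero (suc k) ℤ.* det (suc m) (minor A zero (suc k)))
    ≡⟨ sumFin-cong (suc m) (λ k → cong (ℤ._*_ (sign (toℕ (suc k)) ℤ.* A zero (suc k)))
                                        (det-expandFirstColumn m (minor A zero (suc k)))) ⟩
  sumFin (suc m) (λ k → sign (toℕ (suc k)) ℤ.* A zero (suc k) ℤ.*
    sumFin (suc m) (λ q → sign (toℕ q) ℤ.* A (suc q) zero ℤ.* E q k))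
    ≡⟨ sumFin-interchange (suc m) (λ k → sign (toℕ (suc k)) ℤ.* A zero (suc k)) (λ q → sign (toℕ q) ℤ.* A (suc q) zero)
         (λ k → sign (toℕ k) ℤ.* A zero (suc k)) (λ q → sign (toℕ (suc q)) ℤ.* A (suc q) zero) E
         (λ k q → swapSigns (sign (toℕ k)) (A zero (suc k)) (sign (toℕ q)) (A (suc q) zero)) ⟩
  sumFin (suc m) (λ q → sign (toℕ (suc q)) ℤ.* A (suc q) zero ℤ.*
    sumFin (suc m) (λ k → sign (toℕ k) ℤ.* A zero (suc k) ℤ.* E q k))
    ∎)
  where
  open ≡-Reasoning
  E : Fin (suc m) → Fin (suc m) → ℤ
  E q k = det m (minor (minor A zero zero) q k)
  swapSigns : ∀ s a t b → (- s ℤ.* a) ℤ.* (t ℤ.* b) ≡ (- t ℤ.* b) ℤ.* (s ℤ.* a)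
  swapSigns = solve-∀

det-transpose : ∀ m (A : Matrix m) → det m (λ i j → A j i) ≡ det m A
det-transpose zero A = refl
det-transpose (suc m) A =
  trans (sumFin-cong (suc m) (λ j → cong (ℤ._*_ (sign (toℕ j) ℤ.* A j zero))
                                          (det-transpose m (minor A j zero))))
        (sym (det-expandFirstColumn m A))

det-equalFirstColumns : ∀ m (A : Matrix (suc (suc m))) → (∀ i → A i zero ≡ A i (suc zero)) →
  det (suc (suc m)) A ≡ + 0
det-equalFirstColumns m A col₀≡col₁ =
  trans (cong₂ (λ a d → + 1 ℤ.* A zero zero ℤ.* D ℤ.+ ((- + 1) ℤ.* a ℤ.* d ℤ.+ laterTerms m A))
               (sym (col₀≡col₁ zero)) minor₀₁≡minor₀₀)
  (trans (cong (λ rest → + 1 ℤ.* A zero zero ℤ.* D ℤ.+ ((- + 1) ℤ.* A zero zero ℤ.* D ℤ.+ rest))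
               (laterTerms≡0 m A col₀≡col₁))
         (cancel (A zero zero) D))
  where
  D = det (suc m) (minor A zero zero)
  minor₀₁≡minor₀₀ : det (suc m) (minor A zero (suc zero)) ≡ D
  minor₀₁≡minor₀₀ = det-cong (suc m) {A = minor A zero (suc zero)} {B = minor A zero zero}
    λ { i zero → col₀≡col₁ (suc i) ; i (suc l) → refl }
  cancel : ∀ a d → + 1 ℤ.* a ℤ.* d ℤ.+ ((- + 1) ℤ.* a ℤ.* d ℤ.+ + 0) ≡ + 0
  cancel = solve-∀
  laterTerms : ∀ m → Matrix (suc (suc m)) → ℤ
  laterTerms m A = sumFin m (λ k → firstRowTerm A (suc (suc k)))
  laterTerms≡0 : ∀ m (A : Matrix (suc (suc m))) → (∀ i → A i zero ≡ A i (suc zero)) → laterTerms m A ≡ + 0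
  laterTerms≡0 zero A _ = refl
  laterTerms≡0 (suc m) A col₀≡col₁ = sumFin-zero (suc m) (λ k →
    zero-last (sign (toℕ (suc (suc k)))) (A zero (suc (suc k)))
      (det-equalFirstColumns m (minor A zero (suc (suc k))) (col₀≡col₁ ∘ suc)))

det-equalAdjacentRows : ∀ n (A : Matrix (suc n)) (t : Fin n) →
  (∀ l → A (inject₁ t) l ≡ A (suc t) l) → det (suc n) A ≡ + 0
det-equalAdjacentRows (suc n) A zero row₀≡row₁ =
  trans (sym (det-transpose (suc (suc n)) A)) (det-equalFirstColumns n (λ i j → A j i) row₀≡row₁)
det-equalAdjacentRows (suc n) A (suc t) rowₜ≡rowₜ₊₁ = sumFin-zero (suc (suc n)) (λ j →
  zero-last (sign (toℕ j)) (A zero j)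
    (det-equalAdjacentRows n (minor A zero j) t (λ l → rowₜ≡rowₜ₊₁ (punchIn j l))))

det-linearInRow : ∀ m (p : Fin m) (a : ℤ) (A B C : Matrix m) →
  (∀ i l → i ≢ p → A i l ≡ B i l) → (∀ i l → i ≢ p → A i l ≡ C i l) →
  (∀ l → A p l ≡ B p l ℤ.+ a ℤ.* C p l) → det m A ≡ det m B ℤ.+ a ℤ.* det m C
det-linearInRow (suc m) zero a A B C A≡B A≡C rowₚ =
  sumFin-linear (suc m) a {g = firstRowTerm B} {h = firstRowTerm C} term
  where
  open ≡-Reasoning
  distrib : ∀ s b a c d → s ℤ.* (b ℤ.+ a ℤ.* c) ℤ.* d ≡ s ℤ.* b ℤ.* d ℤ.+ a ℤ.* (s ℤ.* c ℤ.* d)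
  distrib = solve-∀
  term : ∀ j → firstRowTerm A j ≡ firstRowTerm B j ℤ.+ a ℤ.* firstRowTerm C j
  term j = begin
    sⱼ ℤ.* A zero j ℤ.* det m (minor A zero j)
      ≡⟨ cong₂ (λ x d → sⱼ ℤ.* x ℤ.* d) (rowₚ j) (det-cong m (λ i l → A≡B (suc i) (punchIn j l) λ ())) ⟩
    sⱼ ℤ.* (B zero j ℤ.+ a ℤ.* C zero j) ℤ.* det m (minor B zero j)
      ≡⟨ distrib sⱼ (B zero j) a (C zero j) _ ⟩
    firstRowTerm B j ℤ.+ a ℤ.* (sⱼ ℤ.* C zero j ℤ.* det m (minor B zero j))
      ≡⟨ cong (λ d → firstRowTerm B j ℤ.+ a ℤ.* (sⱼ ℤ.* C zero j ℤ.* d))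
              (det-cong m (λ i l → trans (sym (A≡B (suc i) (punchIn j l) λ ())) (A≡C (suc i) (punchIn j l) λ ()))) ⟩
    firstRowTerm B j ℤ.+ a ℤ.* firstRowTerm C j ∎
    where sⱼ = sign (toℕ j)
det-linearInRow (suc m) (suc p) a A B C A≡B A≡C rowₚ =
  sumFin-linear (suc m) a {g = firstRowTerm B} {h = firstRowTerm C} term
  where
  open ≡-Reasoning
  distrib : ∀ s x a d e → s ℤ.* x ℤ.* (d ℤ.+ a ℤ.* e) ≡ s ℤ.* x ℤ.* d ℤ.+ a ℤ.* (s ℤ.* x ℤ.* e)
  distrib = solve-∀
  term : ∀ j → firstRowTerm A j ≡ firstRowTerm B j ℤ.+ a ℤ.* firstRowTerm C j
  term j = begin
    sⱼ ℤ.* A zero j ℤ.* det m (minor A zero j)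
      ≡⟨ cong (ℤ._*_ (sⱼ ℤ.* A zero j))
           (det-linearInRow m p a (minor A zero j) (minor B zero j) (minor C zero j)
              (λ i l i≢p → A≡B (suc i) (punchIn j l) (i≢p ∘ FP.suc-injective))
              (λ i l i≢p → A≡C (suc i) (punchIn j l) (i≢p ∘ FP.suc-injective))
              (λ l → rowₚ (punchIn j l))) ⟩
    sⱼ ℤ.* A zero j ℤ.* (det m (minor B zero j) ℤ.+ a ℤ.* det m (minor C zero j))
      ≡⟨ distrib sⱼ (A zero j) a _ _ ⟩
    sⱼ ℤ.* A zero j ℤ.* det m (minor B zero j) ℤ.+ a ℤ.* (sⱼ ℤ.* A zero j ℤ.* det m (minor C zero j))
      ≡⟨ cong₂ (λ x y → sⱼ ℤ.* x ℤ.* det m (minor B zero j) ℤ.+ a ℤ.* (sⱼ ℤ.* y ℤ.* det m (minor C zero j)))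
               (A≡B zero j λ ()) (A≡C zero j λ ()) ⟩
    firstRowTerm B j ℤ.+ a ℤ.* firstRowTerm C j ∎
    where sⱼ = sign (toℕ j)

inject₁≢suc : ∀ {n} (t : Fin n) → inject₁ t ≢ suc t
inject₁≢suc t eq = NP.1+n≢n (sym (trans (sym (FP.toℕ-inject₁ t)) (cong toℕ eq)))

det-addAdjacentRow : ∀ n (A B : Matrix (suc n)) (t : Fin n) (a : ℤ) →
  (∀ x l → x ≢ suc t → B x l ≡ A x l) →
  (∀ l → B (suc t) l ≡ A (suc t) l ℤ.+ a ℤ.* A (inject₁ t) l) →
  det (suc n) B ≡ det (suc n) A
det-addAdjacentRow n A B t a B≡A rowₜ₊₁ = begin
  det (suc n) B                            ≡⟨ det-linearInRow (suc n) (suc t) a B A Adup B≡A B≡Adup rowₜ₊₁′ ⟩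
  det (suc n) A ℤ.+ a ℤ.* det (suc n) Adup ≡⟨ cong (λ d → det (suc n) A ℤ.+ a ℤ.* d) detAdup≡0 ⟩
  det (suc n) A ℤ.+ a ℤ.* + 0              ≡⟨ cong (ℤ._+_ (det (suc n) A)) (ZP.*-zeroʳ a) ⟩
  det (suc n) A ℤ.+ + 0                    ≡⟨ ZP.+-identityʳ _ ⟩
  det (suc n) A                            ∎
  where
  open ≡-Reasoning
  Adup : Matrix (suc n)
  Adup = updateAt A (suc t) (λ _ → A (inject₁ t))
  B≡Adup : ∀ x l → x ≢ suc t → B x l ≡ Adup x l
  B≡Adup x l x≢t = trans (B≡A x l x≢t) (cong (λ row → row l) (sym (updateAt-minimal x (suc t) A x≢t)))
  rowₜ₊₁′ : ∀ l → B (suc t) l ≡ A (suc t) l ℤ.+ a ℤ.* Adup (suc t) l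
  rowₜ₊₁′ l = trans (rowₜ₊₁ l) (cong (λ row → A (suc t) l ℤ.+ a ℤ.* row l) (sym (updateAt-updates (suc t) A)))
  detAdup≡0 : det (suc n) Adup ≡ + 0
  detAdup≡0 = det-equalAdjacentRows n Adup t (λ l → cong (λ row → row l)
    (trans (updateAt-minimal (inject₁ t) (suc t) A (inject₁≢suc t)) (sym (updateAt-updates (suc t) A))))

differencedFrom : ∀ {n} → ℕ → Matrix (suc n) → Matrix (suc n)
differencedFrom k A zero l = A zero l
differencedFrom k A (suc i) l with k ≤? toℕ i
... | yes _ = A (suc i) l ℤ.- A (inject₁ i) l
... | no _ = A (suc i) l

differencedFrom-below : ∀ {n} k (A : Matrix (suc n)) x l → toℕ x ℕ.≤ k → differencedFrom k A x l ≡ A x l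
differencedFrom-below k A zero l _ = refl
differencedFrom-below k A (suc i) l i<k with k ≤? toℕ i
... | yes k≤i = ⊥-elim (NP.<⇒≱ i<k k≤i)
... | no _ = refl

differencedFrom-above : ∀ {n} k (A : Matrix (suc n)) i l → k ℕ.≤ toℕ i →
  differencedFrom k A (suc i) l ≡ A (suc i) l ℤ.- A (inject₁ i) l
differencedFrom-above k A i l k≤i with k ≤? toℕ i
... | yes _ = refl
... | no k≰i = ⊥-elim (k≰i k≤i)

det-differencedFrom-step : ∀ n (A : Matrix (suc n)) k →
  det (suc n) (differencedFrom k A) ≡ det (suc n) (differencedFrom (suc k) A)
det-differencedFrom-step n A k with k ℕ.<? n
... | no k≮n = det-cong (suc n) (λ x l →
  trans (differencedFrom-below k A x l (x≤k x))
        (sym (differencedFrom-below (suc k) A x l (NP.m≤n⇒m≤1+n (x≤k x)))))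
  where
  x≤k : ∀ (x : Fin (suc n)) → toℕ x ℕ.≤ k
  x≤k x = NP.≤-trans (NP.<⇒≤pred (FP.toℕ<n x)) (NP.≮⇒≥ k≮n)
... | yes k<n = det-addAdjacentRow n (differencedFrom (suc k) A) (differencedFrom k A) t (- + 1) agree rowₜ₊₁
  where
  t = Fin.fromℕ< k<n
  t≡k : toℕ t ≡ k
  t≡k = FP.toℕ-fromℕ< k<n
  agree : ∀ x l → x ≢ suc t → differencedFrom k A x l ≡ differencedFrom (suc k) A x l
  agree zero l _ = refl
  agree (suc i) l i≢t with k ≤? toℕ i | suc k ≤? toℕ i
  ... | yes _ | yes _ = refl
  ... | no _ | no _ = refl
  ... | no k≰i | yes k<i = ⊥-elim (k≰i (NP.<⇒≤ k<i))
  ... | yes k≤i | no k≮i =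
    ⊥-elim (i≢t (cong suc (FP.toℕ-injective (trans (NP.≤-antisym (NP.≮⇒≥ k≮i) k≤i) (sym t≡k)))))
  rowₜ₊₁ : ∀ l → differencedFrom k A (suc t) l ≡
    differencedFrom (suc k) A (suc t) l ℤ.+ (- + 1) ℤ.* differencedFrom (suc k) A (inject₁ t) l
  rowₜ₊₁ l = begin
    differencedFrom k A (suc t) l           ≡⟨ differencedFrom-above k A t l (NP.≤-reflexive (sym t≡k)) ⟩
    A (suc t) l ℤ.- A (inject₁ t) l         ≡⟨ subtraction (A (suc t) l) (A (inject₁ t) l) ⟩
    A (suc t) l ℤ.+ (- + 1) ℤ.* A (inject₁ t) l
      ≡⟨ sym (cong₂ (λ u v → u ℤ.+ (- + 1) ℤ.* v)
           (differencedFrom-below (suc k) A (suc t) l (s≤s (NP.≤-reflexive t≡k)))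
           (differencedFrom-below (suc k) A (inject₁ t) l
              (NP.≤-trans (NP.≤-reflexive (trans (FP.toℕ-inject₁ t) t≡k)) (NP.n≤1+n k)))) ⟩
    differencedFrom (suc k) A (suc t) l ℤ.+ (- + 1) ℤ.* differencedFrom (suc k) A (inject₁ t) l ∎
    where
    open ≡-Reasoning
    subtraction : ∀ a b → a ℤ.- b ≡ a ℤ.+ (- + 1) ℤ.* b
    subtraction = solve-∀

det-rowDifferences : ∀ n (A : Matrix (suc n)) → det (suc n) (differencedFrom 0 A) ≡ det (suc n) A
det-rowDifferences n A =
  trans (chain n) (det-cong (suc n) (λ x l → differencedFrom-below n A x l (NP.<⇒≤pred (FP.toℕ<n x))))
  where
  chain : ∀ k → det (suc n) (differencedFrom 0 A) ≡ det (suc n) (differencedFrom k A)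
  chain zero = refl
  chain (suc k) = trans (chain k) (det-differencedFrom-step n A k)

strictlyIncreasing⇒adjacent : ∀ {m} (r : Fin (suc m) → ℕ) → StrictlyIncreasing r →
  ∀ x → r (inject₁ x) ℕ.< r (suc x)
strictlyIncreasing⇒adjacent r r↑ x = r↑ (inject₁ x) (suc x) (s≤s (NP.≤-reflexive (FP.toℕ-inject₁ x)))

adjacent⇒strictlyIncreasing : ∀ {m} (r : Fin (suc m) → ℕ) → (∀ x → r (inject₁ x) ℕ.< r (suc x)) →
  StrictlyIncreasing r
adjacent⇒strictlyIncreasing {zero} r adj zero zero ()
adjacent⇒strictlyIncreasing {suc m} r adj zero (suc zero) _ = adj zero
adjacent⇒strictlyIncreasing {suc m} r adj zero (suc (suc j)) _ =
  NP.<-trans (adj zero) (adjacent⇒strictlyIncreasing (r ∘ suc) (adj ∘ suc) zero (suc j) ℕ.z<s)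
adjacent⇒strictlyIncreasing {suc m} r adj (suc i) (suc j) (s≤s i<j) =
  adjacent⇒strictlyIncreasing (r ∘ suc) (adj ∘ suc) i j i<j

pred-strictlyIncreasing : ∀ {m} (r : Fin m → ℕ) → (∀ i → 1 ℕ.≤ r i) → StrictlyIncreasing r →
  StrictlyIncreasing (pred ∘ r)
pred-strictlyIncreasing r r⁺ r↑ i j i<j with r i | r j | r⁺ i | r↑ i j i<j
... | suc _ | suc _ | _ | s≤s rᵢ<rⱼ = rᵢ<rⱼ

strictlyIncreasing-positive : ∀ {m} (r : Fin (suc m) → ℕ) → StrictlyIncreasing r → 1 ℕ.≤ r zero →
  ∀ i → 1 ℕ.≤ r i
strictlyIncreasing-positive r r↑ r₀⁺ zero = r₀⁺
strictlyIncreasing-positive r r↑ r₀⁺ (suc i) = NP.≤-trans r₀⁺ (NP.<⇒≤ (r↑ zero (suc i) ℕ.z<s))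

strictlyIncreasing-tail : ∀ {m} (r : Fin (suc m) → ℕ) → StrictlyIncreasing r → StrictlyIncreasing (r ∘ suc)
strictlyIncreasing-tail r r↑ i j i<j = r↑ (suc i) (suc j) (s≤s i<j)

-- Minors of matrices whose rows are interval sums

MinorsNonneg : ∀ {m} → (ℕ → Fin m → ℕ) → Set
MinorsNonneg {m} V = ∀ r → StrictlyIncreasing r → + 0 ℤ.≤ det m (λ i j → + V (r i) j)

-- The sum of the rows a, a + 1, …, a + d: the interval has d + 1 elements.
intervalSum : ∀ {m} → (ℕ → Fin m → ℕ) → ℕ → ℕ → Fin m → ℕ
intervalSum V a d j = sumUpTo (suc d) (λ t → V (a ℕ.+ t) j)

intervalSum-point : ∀ {m} (V : ℕ → Fin m → ℕ) a j → intervalSum V a 0 j ≡ V a j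
intervalSum-point V a j = trans (NP.+-identityʳ _) (cong (λ b → V b j) (NP.+-identityʳ a))

intervalSum-splitLast : ∀ {m} (V : ℕ → Fin m → ℕ) a d j →
  intervalSum V a (suc d) j ≡ intervalSum V a d j ℕ.+ intervalSum V (a ℕ.+ suc d) 0 j
intervalSum-splitLast V a d j =
  trans (sumUpTo-snoc (suc d) (λ t → V (a ℕ.+ t) j))
        (cong (intervalSum V a d j ℕ.+_) (sym (intervalSum-point V (a ℕ.+ suc d) j)))

intervalMatrix : ∀ {m} → (ℕ → Fin m → ℕ) → (lo len : Fin m → ℕ) → Matrix m
intervalMatrix V lo len i j = + intervalSum V (lo i) (len i) j

IntervalsOrdered : ∀ {m} → (lo len : Fin (suc m) → ℕ) → Set
IntervalsOrdered {m} lo len = ∀ (x : Fin m) → lo (inject₁ x) ℕ.+ len (inject₁ x) ℕ.≤ lo (suc x)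

IntervalsOrdered-subintervals : ∀ {m} {lo len lo′ len′ : Fin (suc m) → ℕ} →
  (∀ y → lo y ℕ.≤ lo′ y) → (∀ y → lo′ y ℕ.+ len′ y ℕ.≤ lo y ℕ.+ len y) →
  IntervalsOrdered lo len → IntervalsOrdered lo′ len′
IntervalsOrdered-subintervals lo≤lo′ hi′≤hi ordered x =
  NP.≤-trans (hi′≤hi (inject₁ x)) (NP.≤-trans (ordered x) (lo≤lo′ (suc x)))

det-intervalMatrix-points : ∀ {m} (V : ℕ → Fin (suc m) → ℕ) → MinorsNonneg V → ∀ lo len →
  (∀ i → len i ≡ 0) → IntervalsOrdered lo len → + 0 ℤ.≤ det (suc m) (intervalMatrix V lo len)
det-intervalMatrix-points {m} V V⁺ lo len len≡0 ordered =
  subst (+ 0 ℤ.≤_) (sym (det-cong (suc m) atPoints)) pointRows⁺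
  where
  atPoints : ∀ i j → intervalMatrix V lo len i j ≡ + V (lo i) j
  atPoints i j = cong +_ (trans (cong (λ d → intervalSum V (lo i) d j) (len≡0 i)) (intervalSum-point V (lo i) j))
  pointRows⁺ : + 0 ℤ.≤ det (suc m) (λ i j → + V (lo i) j)
  pointRows⁺ with FP.any? {n = m} (λ x → lo (inject₁ x) ℕ.≟ lo (suc x))
  ... | yes (x , loₓ≡loₓ₊₁) = subst (+ 0 ℤ.≤_)
        (sym (det-equalAdjacentRows m (λ i j → + V (lo i) j) x (λ l → cong (λ t → + V t l) loₓ≡loₓ₊₁)))
        ZP.≤-refl
  ... | no noneEqual = V⁺ lo (adjacent⇒strictlyIncreasing lo (λ x →
        NP.≤∧≢⇒< (NP.≤-trans (NP.m≤m+n _ _) (ordered x)) (λ eq → noneEqual (x , eq))))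

module _ {m} (V : ℕ → Fin (suc m) → ℕ) (lo len : Fin (suc m) → ℕ)
         (i : Fin (suc m)) (d : ℕ) (lenᵢ≡ : len i ≡ suc d) where

  lenWithout : Fin (suc m) → ℕ
  lenWithout = updateAt len i (λ _ → d)

  loLast lenLast : Fin (suc m) → ℕ
  loLast = updateAt lo i (λ _ → lo i ℕ.+ suc d)
  lenLast = updateAt len i (λ _ → 0)

  det-intervalMatrix-splitLast : det (suc m) (intervalMatrix V lo len) ≡
    det (suc m) (intervalMatrix V lo lenWithout) ℤ.+ + 1 ℤ.* det (suc m) (intervalMatrix V loLast lenLast)
  det-intervalMatrix-splitLast = det-linearInRow (suc m) i (+ 1) _ _ _ otherRows₁ otherRows₂ rowᵢ
    where
    otherRows₁ : ∀ y l → y ≢ i → intervalMatrix V lo len y l ≡ intervalMatrix V lo lenWithout y l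
    otherRows₁ y l y≢i = cong (λ e → + intervalSum V (lo y) e l) (sym (updateAt-minimal y i len y≢i))
    otherRows₂ : ∀ y l → y ≢ i → intervalMatrix V lo len y l ≡ intervalMatrix V loLast lenLast y l
    otherRows₂ y l y≢i = cong₂ (λ a e → + intervalSum V a e l)
      (sym (updateAt-minimal y i lo y≢i)) (sym (updateAt-minimal y i len y≢i))
    rowᵢ : ∀ l → intervalMatrix V lo len i l ≡
      intervalMatrix V lo lenWithout i l ℤ.+ + 1 ℤ.* intervalMatrix V loLast lenLast i l
    rowᵢ l = begin
      + intervalSum V (lo i) (len i) l
        ≡⟨ cong (λ e → + intervalSum V (lo i) e l) lenᵢ≡ ⟩
      + intervalSum V (lo i) (suc d) l
        ≡⟨ cong +_ (intervalSum-splitLast V (lo i) d l) ⟩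
      + intervalSum V (lo i) d l ℤ.+ + intervalSum V (lo i ℕ.+ suc d) 0 l
        ≡⟨ cong₂ (λ e x → + intervalSum V (lo i) e l ℤ.+ x) (sym (updateAt-updates i {λ _ → d} len))
             (sym (ZP.*-identityˡ (+ intervalSum V (lo i ℕ.+ suc d) 0 l))) ⟩
      + intervalSum V (lo i) (lenWithout i) l ℤ.+ + 1 ℤ.* + intervalSum V (lo i ℕ.+ suc d) 0 l
        ≡⟨ cong₂ (λ a e → + intervalSum V (lo i) (lenWithout i) l ℤ.+ + 1 ℤ.* + intervalSum V a e l)
             (sym (updateAt-updates i {λ _ → lo i ℕ.+ suc d} lo)) (sym (updateAt-updates i {λ _ → 0} len)) ⟩
      + intervalSum V (lo i) (lenWithout i) l ℤ.+ + 1 ℤ.* + intervalSum V (loLast i) (lenLast i) l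
        ∎
      where open ≡-Reasoning

  IntervalsOrdered-without : IntervalsOrdered lo len → IntervalsOrdered lo lenWithout
  IntervalsOrdered-without = IntervalsOrdered-subintervals {lo = lo} {len} {lo} {lenWithout} (λ _ → NP.≤-refl)
    (λ y → NP.+-monoʳ-≤ (lo y) (updateAt-≤ len i (NP.≤-trans (NP.n≤1+n d) (NP.≤-reflexive (sym lenᵢ≡))) y))

  IntervalsOrdered-last : IntervalsOrdered lo len → IntervalsOrdered loLast lenLast
  IntervalsOrdered-last = IntervalsOrdered-subintervals {lo = lo} {len} {loLast} {lenLast}
    (updateAt-≥ lo i (NP.m≤m+n (lo i) (suc d))) hiLast≤hi
    where
    hiLast≤hi : ∀ y → loLast y ℕ.+ lenLast y ℕ.≤ lo y ℕ.+ len y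
    hiLast≤hi y with y FP.≟ i
    ... | yes refl = NP.≤-reflexive (trans (cong₂ ℕ._+_ (updateAt-updates i lo) (updateAt-updates i len))
                       (trans (NP.+-identityʳ _) (cong (lo i ℕ.+_) (sym lenᵢ≡))))
    ... | no y≢i = NP.≤-reflexive (cong₂ ℕ._+_ (updateAt-minimal y i lo y≢i) (updateAt-minimal y i len y≢i))

-- Induction on the total length: split the last row off a nonsingleton interval by linearity in that row.
det-intervalMatrix-nonneg-bounded : ∀ N {m} (V : ℕ → Fin (suc m) → ℕ) → MinorsNonneg V → ∀ lo len →
  ℕΣ.sum len ℕ.≤ N → IntervalsOrdered lo len → + 0 ℤ.≤ det (suc m) (intervalMatrix V lo len)
det-intervalMatrix-nonneg-bounded N V V⁺ lo len total≤N ordered with FP.any? (λ i → 1 ≤? len i)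
... | no noneLong = det-intervalMatrix-points V V⁺ lo len
      (λ i → NP.n≤0⇒n≡0 (NP.≮⇒≥ (λ 0<lenᵢ → noneLong (i , 0<lenᵢ)))) ordered
det-intervalMatrix-nonneg-bounded zero V V⁺ lo len total≤0 ordered | yes (i , 0<lenᵢ) =
  ⊥-elim (NP.<⇒≱ 0<lenᵢ (NP.≤-trans (≤-sum len i) total≤0))
det-intervalMatrix-nonneg-bounded (suc N) {m} V V⁺ lo len total≤N ordered | yes (i , 0<lenᵢ) =
  subst (+ 0 ℤ.≤_) (sym (det-intervalMatrix-splitLast V lo len i d lenᵢ≡))
    (ZP.+-mono-≤ (recurse lo d<lenᵢ
                    (IntervalsOrdered-without V lo len i d lenᵢ≡ ordered))
                 (subst (+ 0 ℤ.≤_) (sym (ZP.*-identityˡ _))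
                   (recurse (loLast V lo len i d lenᵢ≡) 0<lenᵢ
                     (IntervalsOrdered-last V lo len i d lenᵢ≡ ordered))))
  where
  d = pred (len i)
  lenᵢ≡ : len i ≡ suc d
  lenᵢ≡ = sym (NP.suc-pred (len i) {{ℕ.>-nonZero 0<lenᵢ}})
  d<lenᵢ : d ℕ.< len i
  d<lenᵢ = NP.≤-reflexive (sym lenᵢ≡)
  recurse : ∀ lo′ {v} → v ℕ.< len i → IntervalsOrdered lo′ (updateAt len i (λ _ → v)) →
    + 0 ℤ.≤ det (suc m) (intervalMatrix V lo′ (updateAt len i (λ _ → v)))
  recurse lo′ {v} v<lenᵢ = det-intervalMatrix-nonneg-bounded N V V⁺ lo′ (updateAt len i (λ _ → v))
    (NP.≤-pred (NP.≤-trans (sum-updateAt-< len i v v<lenᵢ) total≤N))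

det-intervalMatrix-nonneg : ∀ {m} (V : ℕ → Fin (suc m) → ℕ) → MinorsNonneg V → ∀ lo len →
  IntervalsOrdered lo len → + 0 ℤ.≤ det (suc m) (intervalMatrix V lo len)
det-intervalMatrix-nonneg V V⁺ lo len = det-intervalMatrix-nonneg-bounded _ V V⁺ lo len NP.≤-refl

-- Row operations preserving nonnegativity of minors

ColumnsTP : (ℕ → ℕ → ℕ) → (m : ℕ) → (Fin m → ℕ) → Set
ColumnsTP M m c = MinorsNonneg (λ t j → M t (c j))

onColumns : ((ℕ → ℕ) → ℕ → ℕ) → (ℕ → ℕ → ℕ) → ℕ → ℕ → ℕ
onColumns op M n k = op (λ t → M t k) n

partialSums : (ℕ → ℕ) → ℕ → ℕ
partialSums g n = sumUpTo (suc n) g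

plusPrevious : (ℕ → ℕ) → ℕ → ℕ
plusPrevious g zero = g zero
plusPrevious g (suc n) = g (suc n) ℕ.+ g n

shiftDown : (ℕ → ℕ) → ℕ → ℕ
shiftDown g zero = 0
shiftDown g (suc n) = g n

0≤1 : + 0 ℤ.≤ + 1
0≤1 = ℤ.+≤+ z≤n

-- Subtracting consecutive rows turns partial sums up to r₀ < r₁ < … into sums over [0, r₀], [r₀ + 1, r₁], ….
ColumnsTP-partialSums : ∀ M m c → ColumnsTP M m c → ColumnsTP (onColumns partialSums M) m c
ColumnsTP-partialSums M zero c _ _ _ = 0≤1
ColumnsTP-partialSums M (suc m) c M⁺ r r↑ =
  subst (+ 0 ℤ.≤_) (trans (sym (det-cong (suc m) differences)) (det-rowDifferences m A))
    (det-intervalMatrix-nonneg V M⁺ lo len ordered)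
  where
  V : ℕ → Fin (suc m) → ℕ
  V t j = M t (c j)
  A : Matrix (suc m)
  A i j = + partialSums (λ t → V t j) (r i)
  lo len : Fin (suc m) → ℕ
  lo zero = 0
  lo (suc i) = suc (r (inject₁ i))
  len zero = r zero
  len (suc i) = r (suc i) ∸ suc (r (inject₁ i))
  lo+len≡r : ∀ y → lo y ℕ.+ len y ≡ r y
  lo+len≡r zero = refl
  lo+len≡r (suc i) = NP.m+[n∸m]≡n (strictlyIncreasing⇒adjacent r r↑ i)
  ordered : IntervalsOrdered lo len
  ordered x = NP.≤-trans (NP.≤-reflexive (lo+len≡r (inject₁ x))) (NP.n≤1+n _)
  differences : ∀ x l → differencedFrom 0 A x l ≡ intervalMatrix V lo len x l
  differences zero l = refl
  differences (suc i) l = begin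
    + sumUpTo (suc (r (suc i))) Vₗ ℤ.- + P₀
      ≡⟨ cong (λ n → + sumUpTo n Vₗ ℤ.- + P₀) (sym suc-r≡) ⟩
    + sumUpTo (lo (suc i) ℕ.+ suc (len (suc i))) Vₗ ℤ.- + P₀
      ≡⟨ cong (λ n → + n ℤ.- + P₀) (sumUpTo-split (lo (suc i)) (suc (len (suc i))) Vₗ) ⟩
    (+ P₀ ℤ.+ intervalMatrix V lo len (suc i) l) ℤ.- + P₀
      ≡⟨ cancel (+ P₀) _ ⟩
    intervalMatrix V lo len (suc i) l ∎
    where
    open ≡-Reasoning
    Vₗ : ℕ → ℕ
    Vₗ t = V t l
    P₀ = partialSums Vₗ (r (inject₁ i))
    suc-r≡ : lo (suc i) ℕ.+ suc (len (suc i)) ≡ suc (r (suc i))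
    suc-r≡ = trans (NP.+-suc (lo (suc i)) _) (cong suc (lo+len≡r (suc i)))
    cancel : ∀ p q → (p ℤ.+ q) ℤ.- p ≡ q
    cancel = solve-∀

ColumnsTP-plusPrevious : ∀ M m c → ColumnsTP M m c → ColumnsTP (onColumns plusPrevious M) m c
ColumnsTP-plusPrevious M zero c _ _ _ = 0≤1
ColumnsTP-plusPrevious M (suc m) c M⁺ r r↑ =
  subst (+ 0 ℤ.≤_) (sym (det-cong (suc m) (λ x l → cong +_ (asInterval (r x) l))))
    (det-intervalMatrix-nonneg V M⁺ (pred ∘ r) (width ∘ r) ordered)
  where
  V : ℕ → Fin (suc m) → ℕ
  V t j = M t (c j)
  width : ℕ → ℕ
  width zero = 0
  width (suc _) = 1
  pred+width : ∀ n → pred n ℕ.+ width n ≡ n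
  pred+width zero = refl
  pred+width (suc n) = NP.+-comm n 1
  asInterval : ∀ n l → plusPrevious (λ t → V t l) n ≡ intervalSum V (pred n) (width n) l
  asInterval zero l = sym (intervalSum-point V 0 l)
  asInterval (suc n) l = trans (NP.+-comm (V (suc n) l) (V n l))
    (cong₂ ℕ._+_ (cong (λ t → V t l) (sym (NP.+-identityʳ n)))
                 (sym (trans (NP.+-identityʳ _) (cong (λ t → V t l) (NP.+-comm n 1)))))
  ordered : IntervalsOrdered (pred ∘ r) (width ∘ r)
  ordered x = NP.≤-trans (NP.≤-reflexive (pred+width (r (inject₁ x))))
                         (NP.<⇒≤pred (strictlyIncreasing⇒adjacent r r↑ x))

ColumnsTP-shiftDown : ∀ M m c → ColumnsTP M m c → ColumnsTP (onColumns shiftDown M) m c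
ColumnsTP-shiftDown M zero c _ _ _ = 0≤1
ColumnsTP-shiftDown M (suc m) c M⁺ r r↑ with r zero ℕ.≟ 0
... | yes r₀≡0 = subst (+ 0 ℤ.≤_)
        (sym (det-zeroFirstRow m (λ i j → + onColumns shiftDown M (r i) (c j))
                                 (λ l → cong (λ n → + shiftDown (λ t → M t (c l)) n) r₀≡0)))
        ZP.≤-refl
... | no r₀≢0 = subst (+ 0 ℤ.≤_) (sym (det-cong (suc m) (λ x l → cong +_ (shifted (λ t → M t (c l)) (r⁺ x)))))
        (M⁺ (pred ∘ r) (pred-strictlyIncreasing r r⁺ r↑))
  where
  r⁺ : ∀ i → 1 ℕ.≤ r i
  r⁺ = strictlyIncreasing-positive r r↑ (NP.n≢0⇒n>0 r₀≢0)
  shifted : ∀ g {n} → 1 ℕ.≤ n → shiftDown g n ≡ g (pred n)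
  shifted g {suc n} _ = refl

ColumnsTP-resp : ∀ M m {c c′ : Fin m → ℕ} → (∀ j → c j ≡ c′ j) → ColumnsTP M m c → ColumnsTP M m c′
ColumnsTP-resp M m c≗c′ M⁺ r r↑ =
  subst (+ 0 ℤ.≤_) (det-cong m (λ i j → cong (λ k → + M (r i) k) (c≗c′ j))) (M⁺ r r↑)

module _ (M : ℕ → ℕ → ℕ) (M₀₀≡1 : M 0 0 ≡ 1) (M₊₀≡0 : ∀ n → M (suc n) 0 ≡ 0)
         (shift⁺ : ∀ m c → ColumnsTP M m c → ColumnsTP M m (suc ∘ c)) where

  private
    vanishesBelowTop : ∀ n → 1 ℕ.≤ n → M n 0 ≡ 0
    vanishesBelowTop (suc n) _ = M₊₀≡0 n

  -- Recursion on c₀: if c₀ > 0 the minor is one of the column-shifted matrix; if c₀ = 0 its first column is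
  -- e₀ or zero, and expanding along it leaves a smaller minor whose columns are all positive.
  ColumnsTP-byColumnInduction : ∀ m c → StrictlyIncreasing c → ColumnsTP M m c
  ColumnsTP-byColumnInduction zero c _ _ _ = 0≤1
  ColumnsTP-byColumnInduction (suc m) c c↑ = byFirstColumn (c zero) c c↑ refl
    where
    byFirstColumn : ∀ a c → StrictlyIncreasing c → c zero ≡ a → ColumnsTP M (suc m) c
    byFirstColumn (suc a) c c↑ c₀≡ = ColumnsTP-resp M (suc m) (λ j → NP.suc-pred (c j) {{ℕ.>-nonZero (c⁺ j)}})
      (shift⁺ (suc m) (pred ∘ c) (byFirstColumn a (pred ∘ c) (pred-strictlyIncreasing c c⁺ c↑) (cong pred c₀≡)))
      where
      c⁺ : ∀ j → 1 ℕ.≤ c j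
      c⁺ = strictlyIncreasing-positive c c↑ (NP.≤-trans (s≤s z≤n) (NP.≤-reflexive (sym c₀≡)))
    byFirstColumn zero c c↑ c₀≡0 r r↑ =
      subst (+ 0 ℤ.≤_) (sym (det-zeroBelowCorner m A belowCorner≡0)) corner*minor⁺
      where
      A : Matrix (suc m)
      A i j = + M (r i) (c j)
      column₀≡0 : ∀ i → 1 ℕ.≤ r i → A i zero ≡ + 0
      column₀≡0 i rᵢ⁺ = cong +_ (trans (cong (M (r i)) c₀≡0) (vanishesBelowTop (r i) rᵢ⁺))
      belowCorner≡0 : ∀ i → A (suc i) zero ≡ + 0
      belowCorner≡0 i = column₀≡0 (suc i) (NP.≤-trans (s≤s z≤n) (r↑ zero (suc i) ℕ.z<s))
      D = det m (minor A zero zero)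
      corner*minor⁺ : + 0 ℤ.≤ A zero zero ℤ.* D
      corner*minor⁺ with r zero ℕ.≟ 0
      ... | yes r₀≡0 = subst (+ 0 ℤ.≤_)
              (trans (sym (ZP.*-identityˡ D)) (cong (ℤ._* D) (cong +_ (sym (trans (cong₂ M r₀≡0 c₀≡0) M₀₀≡1)))))
              (ColumnsTP-byColumnInduction m (c ∘ suc) (strictlyIncreasing-tail c c↑)
                 (r ∘ suc) (strictlyIncreasing-tail r r↑))
      ... | no r₀≢0 = subst (+ 0 ℤ.≤_)
              (sym (trans (cong (ℤ._* D) (column₀≡0 zero (NP.n≢0⇒n>0 r₀≢0))) (ZP.*-zeroˡ D))) ZP.≤-refl

δ₀ : ℕ → ℕ
δ₀ zero = 1
δ₀ (suc _) = 0

-- Coefficientwise multiplication of a power series by (1+x)/(1-x).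
timesRatio : (ℕ → ℕ) → ℕ → ℕ
timesRatio g = plusPrevious (partialSums g)

SCol sCol cCol : ℕ → ℕ → ℕ
SCol zero = δ₀
SCol (suc k) = timesRatio (SCol k)
sCol zero = δ₀
sCol (suc k) = shiftDown (timesRatio (sCol k))
cCol k = timesRatio (sCol k)

byColumns : (ℕ → ℕ → ℕ) → ℕ → ℕ → ℕ
byColumns col n k = col k n

ColumnsTP-timesRatio : ∀ M m c → ColumnsTP M m c → ColumnsTP (onColumns timesRatio M) m c
ColumnsTP-timesRatio M m c =
  ColumnsTP-plusPrevious (onColumns partialSums M) m c ∘ ColumnsTP-partialSums M m c

ColumnsTP-SCol : ∀ m c → StrictlyIncreasing c → ColumnsTP (byColumns SCol) m c
ColumnsTP-SCol = ColumnsTP-byColumnInduction (byColumns SCol) refl (λ _ → refl)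
  (λ m c → ColumnsTP-timesRatio (byColumns SCol) m c)

ColumnsTP-sCol : ∀ m c → StrictlyIncreasing c → ColumnsTP (byColumns sCol) m c
ColumnsTP-sCol = ColumnsTP-byColumnInduction (byColumns sCol) refl (λ _ → refl)
  (λ m c → ColumnsTP-shiftDown (onColumns timesRatio (byColumns sCol)) m c
         ∘ ColumnsTP-timesRatio (byColumns sCol) m c)

ColumnsTP-cCol : ∀ m c → StrictlyIncreasing c → ColumnsTP (byColumns cCol) m c
ColumnsTP-cCol m c c↑ = ColumnsTP-timesRatio (byColumns sCol) m c (ColumnsTP-sCol m c c↑)

timesRatio-formula : ∀ g m → timesRatio g m ≡ g m ℕ.+ 2 ℕ.* sumUpTo m g
timesRatio-formula g zero = refl
timesRatio-formula g (suc n) =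
  trans (cong (ℕ._+ partialSums g n) (sumUpTo-snoc (suc n) g)) (rearrange (partialSums g n) (g (suc n)))
  where
  rearrange : ∀ s a → s ℕ.+ a ℕ.+ s ≡ a ℕ.+ 2 ℕ.* s
  rearrange = NS.solve-∀

VanishesBelow : ℕ → (ℕ → ℕ) → Set
VanishesBelow k g = ∀ t → t ℕ.< k → g t ≡ 0

partialSums-vanishesBelow : ∀ k {g} → VanishesBelow k g → VanishesBelow k (partialSums g)
partialSums-vanishesBelow k g≡0 t t<k = sumUpTo-zero (suc t) (λ i i≤t → g≡0 i (NP.<-≤-trans i≤t t<k))

partialSums-shift : ∀ k {g} → VanishesBelow k g → ∀ n → partialSums g (k ℕ.+ n) ≡ partialSums (λ t → g (k ℕ.+ t)) n
partialSums-shift k {g} g≡0 n =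
  trans (cong (λ l → sumUpTo l g) (sym (NP.+-suc k n)))
  (trans (sumUpTo-split k (suc n) g) (cong (ℕ._+ partialSums (λ t → g (k ℕ.+ t)) n) (sumUpTo-zero k g≡0)))

plusPrevious-vanishesBelow : ∀ k {g} → VanishesBelow k g → VanishesBelow k (plusPrevious g)
plusPrevious-vanishesBelow k g≡0 zero 0<k = g≡0 zero 0<k
plusPrevious-vanishesBelow k g≡0 (suc t) t<k = cong₂ ℕ._+_ (g≡0 (suc t) t<k) (g≡0 t (NP.<-trans (NP.n<1+n t) t<k))

plusPrevious-shift : ∀ k {g} → VanishesBelow k g → ∀ n → plusPrevious g (k ℕ.+ n) ≡ plusPrevious (λ t → g (k ℕ.+ t)) n
plusPrevious-shift zero g≡0 n = refl
plusPrevious-shift (suc k) {g} g≡0 zero =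
  trans (cong (g (suc (k ℕ.+ 0)) ℕ.+_) (g≡0 (k ℕ.+ 0) (s≤s (NP.≤-reflexive (NP.+-identityʳ k))))) (NP.+-identityʳ _)
plusPrevious-shift (suc k) {g} g≡0 (suc n) = cong (λ t → g (suc (k ℕ.+ suc n)) ℕ.+ g t) (NP.+-suc k n)

plusPrevious-cong : ∀ {g h} → (∀ t → g t ≡ h t) → ∀ n → plusPrevious g n ≡ plusPrevious h n
plusPrevious-cong g≗h zero = g≗h zero
plusPrevious-cong g≗h (suc n) = cong₂ ℕ._+_ (g≗h (suc n)) (g≗h n)

timesRatio-cong : ∀ {g h} → (∀ t → g t ≡ h t) → ∀ n → timesRatio g n ≡ timesRatio h n
timesRatio-cong g≗h = plusPrevious-cong (λ t → sumUpTo-cong (suc t) (λ i _ → g≗h i))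

timesRatio-vanishesBelow : ∀ k {g} → VanishesBelow k g → VanishesBelow k (timesRatio g)
timesRatio-vanishesBelow k g≡0 = plusPrevious-vanishesBelow k (partialSums-vanishesBelow k g≡0)

timesRatio-shift : ∀ k {g} → VanishesBelow k g → ∀ n → timesRatio g (k ℕ.+ n) ≡ timesRatio (λ t → g (k ℕ.+ t)) n
timesRatio-shift k g≡0 n = trans (plusPrevious-shift k (partialSums-vanishesBelow k g≡0) n)
  (plusPrevious-cong (partialSums-shift k g≡0) n)

sCol-vanishesBelow : ∀ k → VanishesBelow k (sCol k)
sCol-vanishesBelow (suc k) zero _ = refl
sCol-vanishesBelow (suc k) (suc t) (s≤s t<k) = timesRatio-vanishesBelow k (sCol-vanishesBelow k) t t<k

sCol-shift : ∀ k n → sCol k (k ℕ.+ n) ≡ SCol k n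
sCol-shift zero n = refl
sCol-shift (suc k) n = trans (timesRatio-shift k (sCol-vanishesBelow k) n) (timesRatio-cong (sCol-shift k) n)

cCol-shift : ∀ k n → cCol k (k ℕ.+ n) ≡ SCol (suc k) n
cCol-shift k = sCol-shift (suc k)

-- Counting lattice points

length-filter-concatMap : ∀ {A B : Set} {P : Pred B 0ℓ} (P? : Decidable P) (f : A → List B) (xs : List A) →
  length (filter P? (concatMap f xs)) ≡ sum (map (λ x → length (filter P? (f x))) xs)
length-filter-concatMap P? f [] = refl
length-filter-concatMap P? f (x ∷ xs) = begin
  length (filter P? (f x ++ concatMap f xs))               ≡⟨ cong length (LP.filter-++ P? (f x) (concatMap f xs)) ⟩
  length (filter P? (f x) ++ filter P? (concatMap f xs))   ≡⟨ LP.length-++ (filter P? (f x)) ⟩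
  length (filter P? (f x)) ℕ.+ length (filter P? (concatMap f xs))
    ≡⟨ cong (length (filter P? (f x)) ℕ.+_) (length-filter-concatMap P? f xs) ⟩
  length (filter P? (f x)) ℕ.+ sum (map (λ x → length (filter P? (f x))) xs) ∎
  where open ≡-Reasoning

length-filter-map : ∀ {A B : Set} {P : Pred B 0ℓ} (P? : Decidable P) (g : A → B) (xs : List A) →
  length (filter P? (map g xs)) ≡ length (filter (P? ∘ g) xs)
length-filter-map P? g [] = refl
length-filter-map P? g (y ∷ ys) with does (P? (g y))
... | true = cong suc (length-filter-map P? g ys)
... | false = length-filter-map P? g ys

sum-map-applyUpTo : ∀ (F f : ℕ → ℕ) n → sum (map F (applyUpTo f n)) ≡ sumUpTo n (F ∘ f)
sum-map-applyUpTo F f zero = refl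
sum-map-applyUpTo F f (suc n) = cong (F (f 0) ℕ.+_) (sum-map-applyUpTo F (f ∘ suc) n)

sum-intRange : ∀ N (G : ℕ → ℕ) → sum (map (G ∘ ∣_∣) (intRange N)) ≡ G 0 ℕ.+ 2 ℕ.* sumUpTo N (G ∘ suc)
sum-intRange N G = begin
  sum (map (G ∘ ∣_∣) (map offset (upTo (suc (N ℕ.+ N)))))
    ≡⟨ cong sum (sym (LP.map-∘ (upTo (suc (N ℕ.+ N))))) ⟩
  sum (map F (upTo (suc (N ℕ.+ N))))
    ≡⟨ sum-map-applyUpTo F (λ i → i) (suc (N ℕ.+ N)) ⟩
  sumUpTo (suc (N ℕ.+ N)) F
    ≡⟨ cong (λ l → sumUpTo l F) (sym (NP.+-suc N N)) ⟩
  sumUpTo (N ℕ.+ suc N) F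
    ≡⟨ sumUpTo-split N (suc N) F ⟩
  sumUpTo N F ℕ.+ sumUpTo (suc N) (λ t → F (N ℕ.+ t))
    ≡⟨ cong₂ ℕ._+_ (trans (sumUpTo-cong N (λ i i<N → cong G (∣offset∣-below i (NP.<⇒≤ i<N)))) (sumUpTo-reverse N G))
                   (sumUpTo-cong (suc N) (λ t _ → cong G (∣offset∣-above t))) ⟩
  sumUpTo N (G ∘ suc) ℕ.+ (G 0 ℕ.+ sumUpTo N (G ∘ suc))
    ≡⟨ rearrange (sumUpTo N (G ∘ suc)) (G 0) ⟩
  G 0 ℕ.+ 2 ℕ.* sumUpTo N (G ∘ suc) ∎
  where
  open ≡-Reasoning
  offset : ℕ → ℤ
  offset i = + i ℤ.- + N
  F : ℕ → ℕ
  F i = G ∣ offset i ∣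
  ∣offset∣-below : ∀ i → i ℕ.≤ N → ∣ offset i ∣ ≡ N ∸ i
  ∣offset∣-below i i≤N =
    trans (cong ∣_∣ (ZP.m-n≡m⊖n i N)) (trans (ZP.∣m⊖n∣≡∣n⊖m∣ i N) (cong ∣_∣ (ZP.⊖-≥ i≤N)))
  ∣offset∣-above : ∀ t → ∣ offset (N ℕ.+ t) ∣ ≡ t
  ∣offset∣-above t = cong ∣_∣ (trans (ZP.m-n≡m⊖n (N ℕ.+ t) N)
                      (trans (ZP.⊖-≥ (NP.m≤m+n N t)) (cong +_ (NP.m+n∸m≡n N t))))
  rearrange : ∀ s g → s ℕ.+ (g ℕ.+ s) ≡ g ℕ.+ 2 ℕ.* s
  rearrange = NS.solve-∀

reflectedAt : (ℕ → ℕ) → ℕ → ℕ → ℕ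
reflectedAt g m a with a ≤? m
... | yes _ = g (m ∸ a)
... | no _ = 0

reflectedAt-≤ : ∀ g {m a} → a ℕ.≤ m → reflectedAt g m a ≡ g (m ∸ a)
reflectedAt-≤ g {m} {a} a≤m with a ≤? m
... | yes _ = refl
... | no a≰m = ⊥-elim (a≰m a≤m)

reflectedAt-> : ∀ g {m a} → m ℕ.< a → reflectedAt g m a ≡ 0
reflectedAt-> g {m} {a} m<a with a ≤? m
... | yes a≤m = ⊥-elim (NP.<⇒≱ m<a a≤m)
... | no _ = refl

sumUpTo-reflectedAt : ∀ g {m N} → m ℕ.≤ N → sumUpTo N (reflectedAt g m ∘ suc) ≡ sumUpTo m g
sumUpTo-reflectedAt g {m} {N} m≤N = begin
  sumUpTo N (reflectedAt g m ∘ suc)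
    ≡⟨ cong (λ l → sumUpTo l (reflectedAt g m ∘ suc)) (sym (NP.m+[n∸m]≡n m≤N)) ⟩
  sumUpTo (m ℕ.+ (N ∸ m)) (reflectedAt g m ∘ suc)
    ≡⟨ sumUpTo-split m (N ∸ m) _ ⟩
  sumUpTo m (reflectedAt g m ∘ suc) ℕ.+ sumUpTo (N ∸ m) (λ t → reflectedAt g m (suc (m ℕ.+ t)))
    ≡⟨ cong₂ ℕ._+_
         (sumUpTo-cong m (λ a a<m → trans (reflectedAt-≤ g a<m) (cong g (sym (NP.pred[m∸n]≡m∸[1+n] m a)))))
         (sumUpTo-zero (N ∸ m) (λ t _ → reflectedAt-> g (s≤s (NP.m≤m+n m t)))) ⟩
  sumUpTo m (λ a → g (pred (m ∸ a))) ℕ.+ 0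
    ≡⟨ NP.+-identityʳ _ ⟩
  sumUpTo m (λ a → g (pred (m ∸ a)))
    ≡⟨ sumUpTo-reverse m (g ∘ pred) ⟩
  sumUpTo m g ∎
  where open ≡-Reasoning

boxCount : ℕ → ℕ → ℕ → ℕ
boxCount N k m = length (filter (λ v → l1norm v ℕ.≟ m) (boxVecs N k))

boxCount-withHead : ∀ N k m (x : ℤ) → (∀ m′ → m′ ℕ.≤ N → boxCount N k m′ ≡ SCol k m′) → m ℕ.≤ N →
  length (filter (λ v → l1norm (x ∷ v) ℕ.≟ m) (boxVecs N k)) ≡ reflectedAt (SCol k) m ∣ x ∣
boxCount-withHead N k m x count m≤N with ∣ x ∣ ≤? m
... | yes ∣x∣≤m =
  trans (cong length (LP.filter-≐ (λ v → l1norm (x ∷ v) ℕ.≟ m) (λ v → l1norm v ℕ.≟ (m ∸ ∣ x ∣))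
                                  ((λ {v} → to {v}) , (λ {v} → from {v})) (boxVecs N k)))
        (count (m ∸ ∣ x ∣) (NP.≤-trans (NP.m∸n≤m m ∣ x ∣) m≤N))
  where
  to : ∀ {v : Vec ℤ k} → ∣ x ∣ ℕ.+ l1norm v ≡ m → l1norm v ≡ m ∸ ∣ x ∣
  to {v} eq = sym (trans (cong (_∸ ∣ x ∣) (trans (sym eq) (NP.+-comm ∣ x ∣ (l1norm v))))
                         (NP.m+n∸n≡m (l1norm v) ∣ x ∣))
  from : ∀ {v : Vec ℤ k} → l1norm v ≡ m ∸ ∣ x ∣ → ∣ x ∣ ℕ.+ l1norm v ≡ m
  from eq = trans (cong (∣ x ∣ ℕ.+_) eq) (NP.m+[n∸m]≡n ∣x∣≤m)
... | no ∣x∣≰m = cong length (LP.filter-none (λ v → l1norm (x ∷ v) ℕ.≟ m)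
    (universal (λ v eq → ∣x∣≰m (NP.≤-trans (NP.m≤m+n _ _) (NP.≤-reflexive eq))) (boxVecs N k)))

-- The box of radius N contains all vectors of norm m ≤ N; splitting off the first coordinate x gives
-- S(m, k+1) = Σ_{|x| ≤ m} S(m - |x|, k) = S(m, k) + 2 Σ_{a<m} S(a, k), the recursion of timesRatio.
boxCount-SCol : ∀ k N m → m ℕ.≤ N → boxCount N k m ≡ SCol k m
boxCount-SCol zero N zero _ = refl
boxCount-SCol zero N (suc m) _ = refl
boxCount-SCol (suc k) N m m≤N = begin
  boxCount N (suc k) m
    ≡⟨ length-filter-concatMap (λ v → l1norm v ℕ.≟ m) (λ x → map (x ∷_) (boxVecs N k)) (intRange N) ⟩
  sum (map (λ x → length (filter (λ v → l1norm v ℕ.≟ m) (map (x ∷_) (boxVecs N k)))) (intRange N))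
    ≡⟨ cong sum (LP.map-cong (λ x → trans (length-filter-map (λ v → l1norm v ℕ.≟ m) (x ∷_) (boxVecs N k))
                                          (boxCount-withHead N k m x (boxCount-SCol k N) m≤N)) (intRange N)) ⟩
  sum (map (reflectedAt (SCol k) m ∘ ∣_∣) (intRange N))
    ≡⟨ sum-intRange N (reflectedAt (SCol k) m) ⟩
  reflectedAt (SCol k) m 0 ℕ.+ 2 ℕ.* sumUpTo N (reflectedAt (SCol k) m ∘ suc)
    ≡⟨ cong₂ (λ a b → a ℕ.+ 2 ℕ.* b) (reflectedAt-≤ (SCol k) z≤n) (sumUpTo-reflectedAt (SCol k) m≤N) ⟩
  SCol k m ℕ.+ 2 ℕ.* sumUpTo m (SCol k)
    ≡⟨ sym (timesRatio-formula (SCol k) m) ⟩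
  SCol (suc k) m ∎
  where open ≡-Reasoning

S-entry : ∀ n k → S n k ≡ SCol k n
S-entry n k = boxCount-SCol k n n NP.≤-refl

s-entry : ∀ n k → s n k ≡ sCol k n
s-entry n k with k ≤? n
... | yes k≤n = trans (S-entry (n ∸ k) k)
  (sym (trans (cong (sCol k) (sym (NP.m+[n∸m]≡n k≤n))) (sCol-shift k (n ∸ k))))
... | no k≰n = sym (sCol-vanishesBelow k n (NP.≰⇒> k≰n))

c-entry : ∀ n k → c n k ≡ cCol k n
c-entry n k with k ≤? n
... | yes k≤n = trans (S-entry (n ∸ k) (suc k))
  (sym (trans (cong (cCol k) (sym (NP.m+[n∸m]≡n k≤n))) (cCol-shift k (n ∸ k))))
... | no k≰n = sym (timesRatio-vanishesBelow k (sCol-vanishesBelow k) n (NP.≰⇒> k≰n))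

TotallyPositive-byColumns : ∀ {M} col → (∀ n k → M n k ≡ col k n) →
  (∀ m c → StrictlyIncreasing c → ColumnsTP (byColumns col) m c) → TotallyPositive M
TotallyPositive-byColumns col M≡col col⁺ m r c r↑ c↑ =
  subst (+ 0 ℤ.≤_) (det-cong m (λ i j → cong +_ (sym (M≡col (r i) (c j))))) (col⁺ m c c↑ r r↑)

mainTheorem2 : TotallyPositive S × TotallyPositive s × TotallyPositive C × TotallyPositive c
mainTheorem2 = S⁺ , ŝ⁺ , C⁺ , ĉ⁺
  where
  S⁺ : TotallyPositive S
  S⁺ = TotallyPositive-byColumns SCol S-entry ColumnsTP-SCol
  ŝ⁺ : TotallyPositive s
  ŝ⁺ = TotallyPositive-byColumns sCol s-entry ColumnsTP-sCol
  C⁺ : TotallyPositive C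
  C⁺ m r c r↑ c↑ = S⁺ m r (suc ∘ c) r↑ (λ i j i<j → s≤s (c↑ i j i<j))
  ĉ⁺ : TotallyPositive c
  ĉ⁺ = TotallyPositive-byColumns cCol c-entry ColumnsTP-cCol
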